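{- Let $\alpha$ be an infinite word over $\{0,1,2,3\}$, let $n\ge 2$, and suppose the $(n-1)$-letter factor $\alpha_j\alpha_{j+1}\cdots\alpha_{j+n-2}$ contains $t\ge 1$ non-zero letters and $n-t-1$ zeros. Then for every $i\ge 1$ and $m\ge 1$ the clique-width of $H^\alpha_{i,j}(m,n)$ is at most $6t+3$.
   Context: For an infinite word $\alpha=\alpha_1\alpha_2\cdots$ over $\{0,1,2,3\}$, the infinite graph $\mathcal{P}^\alpha$ has vertex set $\{v_{i,j}: i,j\in\mathbb{N}\}$ ($i$ is the row, $j$ the column). The only edges are between consecutive columns $j$ and $j+1$, determined by $\alpha_j$: if $\alpha_j=0$, $v_{i,j}v_{k,j+1}$ is an edge iff $i=k$; if $\alpha_j=1$, iff $i\neq k$; if $\alpha_j=2$, iff $i\le k$; if $\alpha_j=3$, iff $i\ge k$. $H^\alpha_{i,j}(m,n)$ denotes the induced subgraph of $\mathcal{P}^\alpha$ on $\{v_{x,y}: i\le x\le i+m-1,\ j\le y\le j+n-1\}$. Clique-width is the usual graph parameter. -}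

module Defs where

open import Data.Nat using (ℕ; zero; suc; _+_; _*_; _≤_; _≥_)
open import Data.Fin using (Fin; toℕ; splitAt; _≟_)
open import Data.Product using (_×_; _,_; Σ)
open import Data.Sum using (_⊎_; inj₁; inj₂)
open import Data.Empty using (⊥)
open import Data.Bool using (Bool; true; false; if_then_else_)
open import Relation.Nullary using (¬_; does)
open import Relation.Binary.PropositionalEquality using (_≡_)
open import Function.Bundles using (_↔_; _⇔_; Inverse)

-- Infinite words over {0,1,2,3}: α : ℕ → Fin 4, with αⱼ = α j.
-- (Positions are ℕ; the paper's 1-based indices are used directly,
--  the value α 0 is simply never consulted when j ≥ 1.)

Letter : Set
Letter = Fin 4

Word : Set
Word = ℕ → Letter

-- the relation between row i of column c and row k of column c+1
-- determined by the letter α_c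
LetterRel : Letter → ℕ → ℕ → Set
LetterRel Fin.zero i k = i ≡ k
LetterRel (Fin.suc Fin.zero) i k = ¬ (i ≡ k)
LetterRel (Fin.suc (Fin.suc Fin.zero)) i k = i ≤ k
LetterRel (Fin.suc (Fin.suc (Fin.suc Fin.zero))) i k = i ≥ k

PAdj : Word → ℕ × ℕ → ℕ × ℕ → Set
PAdj α (r , c) (r' , c') =
  (c' ≡ suc c × LetterRel (α c) r r') ⊎ (c ≡ suc c' × LetterRel (α c') r' r)

record Graph : Set₁ where
  field
    V : Set
    E : V → V → Set

open Graph public

H : Word → ℕ → ℕ → ℕ → ℕ → Graph
H α i j m n = record
  { V = Fin m × Fin n
  ; E = λ { (a , b) (a' , b') →
            PAdj α (i + toℕ a , j + toℕ b) (i + toℕ a' , j + toℕ b') } }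

-- Clique-width via k-expressions.
-- Expr k N : a k-expression (labels Fin k) building a graph on N vertices.

data Expr (k : ℕ) : ℕ → Set where
  vertex  : Fin k → Expr k 1
  union   : ∀ {a b} → Expr k a → Expr k b → Expr k (a + b)
  join    : ∀ {N} (p q : Fin k) → ¬ (p ≡ q) → Expr k N → Expr k N
  relabel : ∀ {N} (p q : Fin k) → Expr k N → Expr k N

label : ∀ {k N} → Expr k N → Fin N → Fin k
label (vertex p) _ = p
label (union {a} e f) u with splitAt a u
... | inj₁ x = label e x
... | inj₂ y = label f y
label (join p q _ e) u = label e u
label (relabel p q e) u = if does (label e u ≟ p) then q else label e u

edge : ∀ {k N} → Expr k N → Fin N → Fin N → Set
edge (vertex p) _ _ = ⊥
edge (union {a} e f) u v with splitAt a u | splitAt a v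
... | inj₁ x | inj₁ y = edge e x y
... | inj₂ x | inj₂ y = edge f x y
... | inj₁ _ | inj₂ _ = ⊥
... | inj₂ _ | inj₁ _ = ⊥
edge (join p q _ e) u v =
  edge e u v ⊎ ((label e u ≡ p × label e v ≡ q) ⊎ (label e u ≡ q × label e v ≡ p))
edge (relabel p q e) u v = edge e u v

exprGraph : ∀ {k N} → Expr k N → Graph
exprGraph {N = N} e = record { V = Fin N ; E = edge e }

record _≅_ (G G' : Graph) : Set where
  field
    bij : V G ↔ V G'
    preserves : ∀ u v → E G u v ⇔ E G' (Inverse.to bij u) (Inverse.to bij v)

CliqueWidth≤ : Graph → ℕ → Set
CliqueWidth≤ G k = Σ ℕ (λ N → Σ (Expr k N) (λ e → exprGraph e ≅ G))

nonZeroCount : Word → ℕ → ℕ → ℕ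
nonZeroCount α j zero = 0
nonZeroCount α j (suc l) with α (j + l)
... | Fin.zero = nonZeroCount α j l
... | Fin.suc _ = suc (nonZeroCount α j l)

{-# OPTIONS --safe #-}
module Submission where

-- Build H row by row, adding one vertex at a time (a linear k-expression).  The new
-- vertex in column b can only be adjacent to earlier vertices of columns b − 1 and b + 1,
-- and whether it is adjacent to such a vertex is decided by the letter between the two
-- columns and by whether that vertex is its left neighbour or lies in an earlier row.
-- So it suffices that every earlier vertex carries a label of its column, except the
-- left neighbour, which carries label 1.  A column whose two incident letters are 0 is
-- never adjacent to a later vertex and gets the common label 2; any other column c gets
-- 3 + r(c) + r(c + 1), where r(c) counts the non-zero letters before column c.  These
-- labels are pairwise distinct because r increases across every non-zero letter, and
-- they are at most 2t + 4; with label 0 for the new vertex, 2t + 5 ≤ 6t + 3 labels suffice.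

open import Defs
open import Data.Nat using (ℕ; zero; suc; _+_; _*_; _∸_; pred; _<_; _≤_; _≤′_; ≤′-refl; ≤′-step; s≤s; z≤n; s≤s⁻¹; NonZero; _≟_; _<?_)
open import Data.Nat.Properties
open import Data.Nat.DivMod
open import Data.Nat.Divisibility using (n∣m*n)
open import Data.Nat.Tactic.RingSolver using (solve-∀)
open import Data.Fin as Fin using (Fin; toℕ; fromℕ<; splitAt; _↑ˡ_; _↑ʳ_; remQuot; combine)
open import Data.Fin.Patterns
open import Data.Fin.Properties using (toℕ<n; toℕ-fromℕ<; toℕ-injective; toℕ-↑ˡ; toℕ-↑ʳ; splitAt-↑ˡ; splitAt-↑ʳ; join-splitAt; toℕ-combine; combine-remQuot; remQuot-combine)
open import Data.Bool using (Bool; true; false; T; _∨_; if_then_else_)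
open import Data.Bool.Properties using (T-∨; T?)
open import Data.Unit using (tt)
open import Data.Empty using (⊥; ⊥-elim)
open import Data.List using (List; []; _∷_; filter; allFin)
open import Data.List.Membership.Propositional using (_∈_)
open import Data.List.Membership.Propositional.Properties using (∈-filter⁺; ∈-filter⁻; ∈-allFin)
open import Data.List.Relation.Unary.Any using (here; there)
open import Data.Product using (Σ; ∃-syntax; _×_; _,_; proj₁; proj₂; uncurry)
open import Data.Product.Function.NonDependent.Propositional using (_×-⇔_)
open import Data.Sum using (_⊎_; inj₁; inj₂; [_,_])
open import Data.Sum.Function.Propositional using (_⊎-⇔_)
open import Function using (id)
open import Function.Bundles using (_⇔_; mk⇔; Equivalence; _↔_; mk↔ₛ′; Inverse)
open import Function.Construct.Composition using (_⇔-∘_)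
open import Function.Construct.Identity using (⇔-id)
open import Function.Construct.Symmetry using (⇔-sym)
open import Function.Related.Propositional using (module EquationalReasoning)
open import Relation.Nullary using (¬_; yes; no; Dec; does; contradiction; ¬?; _×-dec_; _⊎-dec_)
open import Relation.Nullary.Decidable using (dec-true; dec-false)
open import Relation.Unary using (Decidable)
open import Relation.Binary.Definitions using (tri<; tri≈; tri>)
open import Relation.Binary.PropositionalEquality hiding ([_])

Linked : ∀ {k} → Fin k → Fin k → Fin k → Fin k → Set
Linked p q a b = (a ≡ p × b ≡ q) ⊎ (a ≡ q × b ≡ p)

joinAll : ∀ {k N} → Fin k → List (Fin k) → Expr k N → Expr k N
joinAll p []       e = e
joinAll p (q ∷ qs) e with p Fin.≟ q
... | yes _   = joinAll p qs e
... | no p≢q = join p q p≢q (joinAll p qs e)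

label-joinAll : ∀ {k N} p qs (e : Expr k N) u → label (joinAll p qs e) u ≡ label e u
label-joinAll p []       e u = refl
label-joinAll p (q ∷ qs) e u with p Fin.≟ q
... | yes _ = label-joinAll p qs e u
... | no _  = label-joinAll p qs e u

edge-joinAll : ∀ {k N} p qs (e : Expr k N) u v →
  edge (joinAll p qs e) u v ⇔
  (edge e u v ⊎ ∃[ q ] q ∈ qs × p ≢ q × Linked p q (label e u) (label e v))
edge-joinAll p [] e u v = mk⇔ inj₁ [ id , (λ { (_ , () , _) }) ]
edge-joinAll p (q ∷ qs) e u v with p Fin.≟ q | edge-joinAll p qs e u v
... | yes p≡q | ih = mk⇔ (λ uv → [ inj₁ , (λ { (r , r∈ , p≢r , l) → inj₂ (r , there r∈ , p≢r , l) }) ]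
                                   (Equivalence.to ih uv))
                        [ (λ uv → Equivalence.from ih (inj₁ uv)) , from ]
  where
  from : ∃[ r ] r ∈ q ∷ qs × p ≢ r × Linked p r (label e u) (label e v) →
         edge (joinAll p qs e) u v
  from (r , here refl , p≢r , _) = contradiction p≡q p≢r
  from (r , there r∈ , p≢r , l) = Equivalence.from ih (inj₂ (r , r∈ , p≢r , l))
... | no p≢q | ih
  rewrite label-joinAll p qs e u | label-joinAll p qs e v = mk⇔ to from
  where
  to : edge (joinAll p qs e) u v ⊎ Linked p q (label e u) (label e v) →
       edge e u v ⊎ ∃[ r ] r ∈ q ∷ qs × p ≢ r × Linked p r (label e u) (label e v)
  to (inj₁ uv) = [ inj₁ , (λ { (r , r∈ , p≢r , l) → inj₂ (r , there r∈ , p≢r , l) }) ]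
                   (Equivalence.to ih uv)
  to (inj₂ l) = inj₂ (q , here refl , p≢q , l)
  from : edge e u v ⊎ ∃[ r ] r ∈ q ∷ qs × p ≢ r × Linked p r (label e u) (label e v) →
         edge (joinAll p qs e) u v ⊎ Linked p q (label e u) (label e v)
  from (inj₁ uv) = inj₁ (Equivalence.from ih (inj₁ uv))
  from (inj₂ (r , here refl , _ , l)) = inj₂ l
  from (inj₂ (r , there r∈ , p≢r , l)) = inj₁ (Equivalence.from ih (inj₂ (r , r∈ , p≢r , l)))

Linked-sym : ∀ {k} {p q a b : Fin k} → Linked p q a b → Linked p q b a
Linked-sym (inj₁ (a≡p , b≡q)) = inj₂ (b≡q , a≡p)
Linked-sym (inj₂ (a≡q , b≡p)) = inj₁ (b≡p , a≡q)

∈-filter-allFin : ∀ {k} {P : Fin k → Set} (P? : Decidable P) {q} →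
                  q ∈ filter P? (allFin k) ⇔ P q
∈-filter-allFin {k} P? {q} =
  mk⇔ (λ q∈ → proj₂ (∈-filter⁻ P? {xs = allFin k} q∈)) (∈-filter⁺ P? (∈-allFin q))

-- label (relabel p q e) u reduces to rename p q (label e u).
rename : ∀ {k} → Fin k → Fin k → Fin k → Fin k
rename p q l = if does (l Fin.≟ p) then q else l

rename-≡ : ∀ {k} {p q l : Fin k} → l ≡ p → rename p q l ≡ q
rename-≡ {p = p} {l = l} l≡p rewrite dec-true (l Fin.≟ p) l≡p = refl

rename-≢ : ∀ {k} {p q l : Fin k} → l ≢ p → rename p q l ≡ l
rename-≢ {p = p} {l = l} l≢p rewrite dec-false (l Fin.≟ p) l≢p = refl

data Extension (s : ℕ) : Fin (s + 1) → Set where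
  old : (z : Fin s) → Extension s (z ↑ˡ 1)
  new : Extension s (s ↑ʳ 0F)

extension : ∀ s u → Extension s u
extension s u with splitAt s u | join-splitAt s 1 u
... | inj₁ z  | refl = old z
... | inj₂ 0F | refl = new

toℕ-new : ∀ s → toℕ {s + 1} (s ↑ʳ 0F) ≡ s
toℕ-new s = trans (toℕ-↑ʳ s 0F) (+-identityʳ s)

module _ {k a b} (e : Expr k a) (f : Expr k b) where

  label-union-↑ˡ : ∀ z → label (union e f) (z ↑ˡ b) ≡ label e z
  label-union-↑ˡ z rewrite splitAt-↑ˡ a z b = refl

  label-union-↑ʳ : ∀ z → label (union e f) (a ↑ʳ z) ≡ label f z
  label-union-↑ʳ z rewrite splitAt-↑ʳ a b z = refl

  edge-union-↑ˡ : ∀ z w → edge (union e f) (z ↑ˡ b) (w ↑ˡ b) ≡ edge e z w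
  edge-union-↑ˡ z w rewrite splitAt-↑ˡ a z b | splitAt-↑ˡ a w b = refl

  edge-union-↑ʳ : ∀ z w → edge (union e f) (a ↑ʳ z) (a ↑ʳ w) ≡ edge f z w
  edge-union-↑ʳ z w rewrite splitAt-↑ʳ a b z | splitAt-↑ʳ a b w = refl

  edge-union-↑ˡ↑ʳ : ∀ z w → ¬ edge (union e f) (z ↑ˡ b) (a ↑ʳ w)
  edge-union-↑ˡ↑ʳ z w rewrite splitAt-↑ˡ a z b | splitAt-↑ʳ a b w = λ ()

  edge-union-↑ʳ↑ˡ : ∀ z w → ¬ edge (union e f) (a ↑ʳ z) (w ↑ˡ b)
  edge-union-↑ʳ↑ˡ z w rewrite splitAt-↑ʳ a b z | splitAt-↑ˡ a w b = λ ()

⊎-⇔-dropʳ : ∀ {A C D : Set} → ¬ C → A ⇔ D → (A ⊎ C) ⇔ D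
⊎-⇔-dropʳ ¬c a⇔d =
  mk⇔ [ Equivalence.to a⇔d , (λ c → contradiction c ¬c) ] (λ d → inj₁ (Equivalence.from a⇔d d))

⊎-⇔-dropˡ : ∀ {A C D : Set} → ¬ A → C ⇔ D → (A ⊎ C) ⇔ D
⊎-⇔-dropˡ ¬a c⇔d =
  mk⇔ [ (λ a → contradiction a ¬a) , Equivalence.to c⇔d ] (λ d → inj₂ (Equivalence.from c⇔d d))

-- Step s adds vertex s with label 0, joins label 0 to every label l with Joins s l, then
-- renames label 1 to retire s and label 0 to labelAt (suc s) s.  Thus labelAt s u is the
-- label of vertex u < s once the vertices 0, …, s − 1 are present.
record LinearLabelling (k : ℕ) (Adj : ℕ → ℕ → Set) : Set₁ where
  field
    labelAt        : ℕ → ℕ → ℕ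
    Joins          : ℕ → ℕ → Set
    joins?         : ∀ s l → Dec (Joins s l)
    retire         : ℕ → ℕ
    labelAt<k      : ∀ {s u} → u < s → labelAt s u < k
    retire<k       : ∀ s → retire s < k
    labelAt≢0      : ∀ {s u} → u < s → labelAt s u ≢ 0
    adjacent⇔joins : ∀ {s u} → u < s → Adj u s ⇔ Joins s (labelAt s u)
    labelAt-retire : ∀ {s u} → u < s → labelAt s u ≡ 1 → labelAt (suc s) u ≡ retire s
    labelAt-keep   : ∀ {s u} → u < s → labelAt s u ≢ 1 → labelAt (suc s) u ≡ labelAt s u

module _ {k : ℕ} {Adj : ℕ → ℕ → Set}
         (Adj-sym : ∀ u v → Adj u v → Adj v u) (Adj-irrefl : ∀ u → ¬ Adj u u)
         (1<k : 1 < k) (L : LinearLabelling k Adj) where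
  open LinearLabelling L

  record Represents {s} (e : Expr k s) : Set where
    field
      edge⇔  : ∀ u v → edge e u v ⇔ Adj (toℕ u) (toℕ v)
      label≡ : ∀ u → toℕ (label e u) ≡ labelAt s (toℕ u)

  fresh recent : Fin k
  fresh  = fromℕ< (<-trans (s≤s z≤n) 1<k)
  recent = fromℕ< 1<k

  toℕ-fresh : toℕ fresh ≡ 0
  toℕ-fresh = toℕ-fromℕ< _

  toℕ-recent : toℕ recent ≡ 1
  toℕ-recent = toℕ-fromℕ< 1<k

  fresh≢recent : fresh ≢ recent
  fresh≢recent ≡recent = 0≢1+n (trans (sym toℕ-fresh) (trans (cong toℕ ≡recent) toℕ-recent))

  ≢fresh : ∀ {l} → toℕ l ≢ 0 → l ≢ fresh
  ≢fresh l≢0 l≡fresh = l≢0 (trans (cong toℕ l≡fresh) toℕ-fresh)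

  joinLabels : ℕ → List (Fin k)
  joinLabels s = filter (λ q → joins? s (toℕ q)) (allFin k)

  JoinedAt : ℕ → Fin k → Fin k → Set
  JoinedAt s a b = ∃[ q ] q ∈ joinLabels s × fresh ≢ q × Linked fresh q a b

  JoinedAt-sym : ∀ {s a b} → JoinedAt s a b → JoinedAt s b a
  JoinedAt-sym (q , q∈ , fresh≢q , linked) = q , q∈ , fresh≢q , Linked-sym linked

  JoinedAt-old : ∀ {s a b} → a ≢ fresh → b ≢ fresh → ¬ JoinedAt s a b
  JoinedAt-old a≢ b≢ (_ , _ , _ , inj₁ (a≡ , _)) = a≢ a≡
  JoinedAt-old a≢ b≢ (_ , _ , _ , inj₂ (_ , b≡)) = b≢ b≡

  JoinedAt-new : ∀ {s} → ¬ JoinedAt s fresh fresh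
  JoinedAt-new (_ , _ , fresh≢q , inj₁ (_ , fresh≡q)) = fresh≢q fresh≡q
  JoinedAt-new (_ , _ , fresh≢q , inj₂ (fresh≡q , _)) = fresh≢q fresh≡q

  JoinedAt-fresh⇔ : ∀ {s a} → a ≢ fresh → JoinedAt s a fresh ⇔ Joins s (toℕ a)
  JoinedAt-fresh⇔ {s} {a} a≢fresh = mk⇔ to from
    where
    to : JoinedAt s a fresh → Joins s (toℕ a)
    to (q , q∈ , _ , inj₁ (a≡fresh , _)) = contradiction a≡fresh a≢fresh
    to (q , q∈ , _ , inj₂ (refl , _))    = Equivalence.to (∈-filter-allFin _) q∈
    from : Joins s (toℕ a) → JoinedAt s a fresh
    from j = a , Equivalence.from (∈-filter-allFin (λ q → joins? s (toℕ q))) j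
               , (λ fresh≡a → a≢fresh (sym fresh≡a)) , inj₂ (refl , refl)

  extend : ∀ {s} → Expr k s → Expr k (s + 1)
  extend {s} e =
    relabel fresh (fromℕ< (labelAt<k (n<1+n s)))
      (relabel recent (fromℕ< (retire<k s))
        (joinAll fresh (joinLabels s) (union e (vertex fresh))))

  module Extend {s} (e : Expr k s) (rep : Represents e) where
    open Represents rep

    B : Expr k (s + 1)
    B = union e (vertex fresh)

    label-B-old : ∀ z → label B (z ↑ˡ 1) ≡ label e z
    label-B-old = label-union-↑ˡ e (vertex fresh)

    label-B-new : label B (s ↑ʳ 0F) ≡ fresh
    label-B-new = label-union-↑ʳ e (vertex fresh) 0F

    toℕ-label-B-old : ∀ z → toℕ (label B (z ↑ˡ 1)) ≡ labelAt s (toℕ z)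
    toℕ-label-B-old z = trans (cong toℕ (label-B-old z)) (label≡ z)

    label-B-old≢fresh : ∀ z → label B (z ↑ˡ 1) ≢ fresh
    label-B-old≢fresh z = ≢fresh (subst (_≢ 0) (sym (toℕ-label-B-old z)) (labelAt≢0 (toℕ<n z)))

    edge-extend⇔ : ∀ u v →
      edge (extend e) u v ⇔ (edge B u v ⊎ JoinedAt s (label B u) (label B v))
    edge-extend⇔ = edge-joinAll fresh (joinLabels s) B

    joinedToNew⇔ : ∀ z → JoinedAt s (label B (z ↑ˡ 1)) (label B (s ↑ʳ 0F)) ⇔ Adj (toℕ z) s
    joinedToNew⇔ z = begin
      JoinedAt s (label B (z ↑ˡ 1)) (label B (s ↑ʳ 0F))  ≡⟨ cong (JoinedAt s _) label-B-new ⟩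
      JoinedAt s (label B (z ↑ˡ 1)) fresh                ∼⟨ JoinedAt-fresh⇔ (label-B-old≢fresh z) ⟩
      Joins s (toℕ (label B (z ↑ˡ 1)))                   ≡⟨ cong (Joins s) (toℕ-label-B-old z) ⟩
      Joins s (labelAt s (toℕ z))                        ∼⟨ ⇔-sym (adjacent⇔joins (toℕ<n z)) ⟩
      Adj (toℕ z) s                                      ∎
      where open EquationalReasoning

    edge⇔′ : ∀ u v → edge (extend e) u v ⇔ Adj (toℕ u) (toℕ v)
    edge⇔′ u v with extension s u | extension s v
    ... | old z | old w rewrite toℕ-↑ˡ z 1 | toℕ-↑ˡ w 1 =
      ⊎-⇔-dropʳ (JoinedAt-old (label-B-old≢fresh z) (label-B-old≢fresh w))
                (subst (_⇔ Adj (toℕ z) (toℕ w)) (sym (edge-union-↑ˡ e (vertex fresh) z w))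
                       (edge⇔ z w))
      ⇔-∘ edge-extend⇔ (z ↑ˡ 1) (w ↑ˡ 1)
    ... | old z | new rewrite toℕ-↑ˡ z 1 | toℕ-new s =
      ⊎-⇔-dropˡ (edge-union-↑ˡ↑ʳ e (vertex fresh) z 0F) (joinedToNew⇔ z)
      ⇔-∘ edge-extend⇔ (z ↑ˡ 1) (s ↑ʳ 0F)
    ... | new | old w rewrite toℕ-↑ˡ w 1 | toℕ-new s =
      mk⇔ (Adj-sym _ _) (Adj-sym _ _)
      ⇔-∘ (⊎-⇔-dropˡ (edge-union-↑ʳ↑ˡ e (vertex fresh) 0F w)
                     (joinedToNew⇔ w ⇔-∘ mk⇔ JoinedAt-sym JoinedAt-sym)
      ⇔-∘ edge-extend⇔ (s ↑ʳ 0F) (w ↑ˡ 1))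
    ... | new | new rewrite toℕ-new s =
      mk⇔ (λ ss → ⊥-elim ([ edge-union-↑ʳ↑ʳ , noJoin ] (Equivalence.to (edge-extend⇔ _ _) ss)))
          (λ ss → contradiction ss (Adj-irrefl s))
      where
      edge-union-↑ʳ↑ʳ : ¬ edge B (s ↑ʳ 0F) (s ↑ʳ 0F)
      edge-union-↑ʳ↑ʳ ss = subst id (edge-union-↑ʳ e (vertex fresh) 0F 0F) ss
      noJoin : ¬ JoinedAt s (label B (s ↑ʳ 0F)) (label B (s ↑ʳ 0F))
      noJoin = subst (λ l → ¬ JoinedAt s l l) (sym label-B-new) JoinedAt-new

    X Y : Fin k
    X = fromℕ< (retire<k s)
    Y = fromℕ< (labelAt<k (n<1+n s))

    label-extend : ∀ u → label (extend e) u ≡ rename fresh Y (rename recent X (label B u))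
    label-extend u =
      cong (λ l → rename fresh Y (rename recent X l)) (label-joinAll fresh (joinLabels s) B u)

    toℕ-retired : ∀ z → toℕ (rename recent X (label e z)) ≡ labelAt (suc s) (toℕ z)
    toℕ-retired z with labelAt s (toℕ z) ≟ 1
    ... | yes ≡1 = begin
      toℕ (rename recent X (label e z))
        ≡⟨ cong toℕ (rename-≡ (toℕ-injective (trans (label≡ z) (trans ≡1 (sym toℕ-recent))))) ⟩
      toℕ X                      ≡⟨ toℕ-fromℕ< _ ⟩
      retire s                   ≡⟨ labelAt-retire (toℕ<n z) ≡1 ⟨
      labelAt (suc s) (toℕ z)    ∎
      where open ≡-Reasoning
    ... | no ≢1 = begin
      toℕ (rename recent X (label e z))
        ≡⟨ cong toℕ (rename-≢ (λ ≡recent → ≢1 (trans (sym (label≡ z))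
                                                     (trans (cong toℕ ≡recent) toℕ-recent)))) ⟩
      toℕ (label e z)            ≡⟨ label≡ z ⟩
      labelAt s (toℕ z)          ≡⟨ labelAt-keep (toℕ<n z) ≢1 ⟨
      labelAt (suc s) (toℕ z)    ∎
      where open ≡-Reasoning

    toℕ-label-extend : ∀ u → toℕ (label (extend e) u) ≡ labelAt (suc s) (toℕ u)
    toℕ-label-extend u with extension s u
    ... | old z = begin
      toℕ (label (extend e) (z ↑ˡ 1))
        ≡⟨ cong toℕ (label-extend (z ↑ˡ 1)) ⟩
      toℕ (rename fresh Y (rename recent X (label B (z ↑ˡ 1))))
        ≡⟨ cong (λ l → toℕ (rename fresh Y (rename recent X l))) (label-B-old z) ⟩
      toℕ (rename fresh Y (rename recent X (label e z)))
        ≡⟨ cong toℕ (rename-≢ (≢fresh (subst (_≢ 0) (sym (toℕ-retired z))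
                                                   (labelAt≢0 (m<n⇒m<1+n (toℕ<n z)))))) ⟩
      toℕ (rename recent X (label e z))
        ≡⟨ toℕ-retired z ⟩
      labelAt (suc s) (toℕ z)
        ≡⟨ cong (labelAt (suc s)) (toℕ-↑ˡ z 1) ⟨
      labelAt (suc s) (toℕ (z ↑ˡ 1)) ∎
      where open ≡-Reasoning
    ... | new = begin
      toℕ (label (extend e) (s ↑ʳ 0F))
        ≡⟨ cong toℕ (label-extend (s ↑ʳ 0F)) ⟩
      toℕ (rename fresh Y (rename recent X (label B (s ↑ʳ 0F))))
        ≡⟨ cong (λ l → toℕ (rename fresh Y (rename recent X l))) label-B-new ⟩
      toℕ (rename fresh Y (rename recent X fresh))
        ≡⟨ cong (λ l → toℕ (rename fresh Y l)) (rename-≢ fresh≢recent) ⟩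
      toℕ (rename fresh Y fresh)
        ≡⟨ cong toℕ (rename-≡ {p = fresh} refl) ⟩
      toℕ Y
        ≡⟨ toℕ-fromℕ< _ ⟩
      labelAt (suc s) s
        ≡⟨ cong (labelAt (suc s)) (toℕ-new s) ⟨
      labelAt (suc s) (toℕ (s ↑ʳ 0F)) ∎
      where open ≡-Reasoning

  extend-represents : ∀ {s} (e : Expr k s) → Represents e → Represents (extend e)
  extend-represents {s} e rep = record
    { edge⇔  = edge⇔′
    ; label≡ = λ u → subst (λ s′ → toℕ (label (extend e) u) ≡ labelAt s′ (toℕ u)) (+-comm 1 s)
                           (toℕ-label-extend u)
    }
    where open Extend e rep

  initial : Expr k 1
  initial = relabel fresh (fromℕ< (labelAt<k {1} {0} (s≤s z≤n))) (vertex fresh)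

  initial-represents : Represents initial
  initial-represents = record
    { edge⇔  = λ { 0F 0F → mk⇔ ⊥-elim (λ adj → contradiction adj (Adj-irrefl 0)) }
    ; label≡ = λ { 0F → trans (cong toℕ (rename-≡ {p = fresh} refl)) (toℕ-fromℕ< _) }
    }

  linearExpression : ∀ N → Σ (Expr k (suc N)) Represents
  linearExpression zero    = initial , initial-represents
  linearExpression (suc N) with linearExpression N
  ... | e , rep = subst (λ M → Σ (Expr k M) Represents) (+-comm (suc N) 1)
                        (extend e , extend-represents e rep)

relatesEqual relatesUpward relatesDownward isNonZero : Letter → Bool
relatesEqual 0F = true
relatesEqual 1F = false
relatesEqual 2F = true
relatesEqual 3F = true

relatesUpward 0F = false
relatesUpward 1F = true
relatesUpward 2F = true
relatesUpward 3F = false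

relatesDownward 0F = false
relatesDownward 1F = true
relatesDownward 2F = false
relatesDownward 3F = true

isNonZero 0F = false
isNonZero 1F = true
isNonZero 2F = true
isNonZero 3F = true

LetterRel-refl⇔ : ∀ L x → LetterRel L x x ⇔ T (relatesEqual L)
LetterRel-refl⇔ 0F x = mk⇔ _ (λ _ → refl)
LetterRel-refl⇔ 1F x = mk⇔ (λ x≢x → x≢x refl) (λ ())
LetterRel-refl⇔ 2F x = mk⇔ _ (λ _ → ≤-refl)
LetterRel-refl⇔ 3F x = mk⇔ _ (λ _ → ≤-refl)

LetterRel-<⇔ : ∀ L {x y} → x < y → LetterRel L x y ⇔ T (relatesUpward L)
LetterRel-<⇔ 0F x<y = mk⇔ (<⇒≢ x<y) (λ ())
LetterRel-<⇔ 1F x<y = mk⇔ _ (λ _ → <⇒≢ x<y)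
LetterRel-<⇔ 2F x<y = mk⇔ _ (λ _ → <⇒≤ x<y)
LetterRel-<⇔ 3F x<y = mk⇔ (<⇒≱ x<y) (λ ())

LetterRel->⇔ : ∀ L {x y} → y < x → LetterRel L x y ⇔ T (relatesDownward L)
LetterRel->⇔ 0F y<x = mk⇔ (>⇒≢ y<x) (λ ())
LetterRel->⇔ 1F y<x = mk⇔ _ (λ _ → >⇒≢ y<x)
LetterRel->⇔ 2F y<x = mk⇔ (<⇒≱ y<x) (λ ())
LetterRel->⇔ 3F y<x = mk⇔ _ (λ _ → <⇒≤ y<x)

relatesUpward⇒isNonZero : ∀ L → T (relatesUpward L) → T (isNonZero L)
relatesUpward⇒isNonZero 1F _ = tt
relatesUpward⇒isNonZero 2F _ = tt
relatesUpward⇒isNonZero 3F ()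

relatesDownward⇒isNonZero : ∀ L → T (relatesDownward L) → T (isNonZero L)
relatesDownward⇒isNonZero 1F _ = tt
relatesDownward⇒isNonZero 3F _ = tt
relatesDownward⇒isNonZero 2F ()

module _ (α : Word) (j : ℕ) where

  nonZeroCount-suc : ∀ c → T (isNonZero (α (j + c))) →
                     nonZeroCount α j (suc c) ≡ suc (nonZeroCount α j c)
  nonZeroCount-suc c nz with α (j + c) | nz
  ... | 1F | _ = refl
  ... | 2F | _ = refl
  ... | 3F | _ = refl

  nonZeroCount-suc-≤ : ∀ c → nonZeroCount α j (suc c) ≤ suc (nonZeroCount α j c)
  nonZeroCount-suc-≤ c with α (j + c)
  ... | 0F = n≤1+n _
  ... | Fin.suc _ = ≤-refl

  nonZeroCount-≤-suc : ∀ c → nonZeroCount α j c ≤ nonZeroCount α j (suc c)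
  nonZeroCount-≤-suc c with α (j + c)
  ... | 0F = ≤-refl
  ... | Fin.suc _ = n≤1+n _

  nonZeroCount-mono : ∀ {c c′} → c ≤ c′ → nonZeroCount α j c ≤ nonZeroCount α j c′
  nonZeroCount-mono c≤c′ = mono (≤⇒≤′ c≤c′)
    where
    mono : ∀ {c c′} → c ≤′ c′ → nonZeroCount α j c ≤ nonZeroCount α j c′
    mono ≤′-refl = ≤-refl
    mono (≤′-step {c′} c≤′c′) = ≤-trans (mono c≤′c′) (nonZeroCount-≤-suc c′)

module _ {n : ℕ} .{{_ : NonZero n}} where

  [m+kn]%n≡m : ∀ {m} k → m < n → (m + k * n) % n ≡ m
  [m+kn]%n≡m {m} k m<n = trans ([m+kn]%n≡m%n m k n) (m<n⇒m%n≡m m<n)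

  [m+kn]/n≡k : ∀ {m} k → m < n → (m + k * n) / n ≡ k
  [m+kn]/n≡k {m} k m<n = begin
    (m + k * n) / n     ≡⟨ +-distrib-/-∣ʳ m (n∣m*n k) ⟩
    m / n + k * n / n   ≡⟨ cong₂ _+_ (m<n⇒m/n≡0 m<n) (m*n/n≡m k n) ⟩
    k                   ∎
    where open ≡-Reasoning

module Grid (n : ℕ) .{{_ : NonZero n}} where

  row col : ℕ → ℕ
  row s = s / n
  col s = s % n

  col<n : ∀ s → col s < n
  col<n s = m%n<n s n

  col+row*n : ∀ s → col s + row s * n ≡ s
  col+row*n s = sym (m≡m%n+[m/n]*n s n)

  lexicographic : ∀ {u s} → u < s → row u < row s ⊎ (row u ≡ row s × col u < col s)
  lexicographic {u} {s} u<s with m≤n⇒m<n∨m≡n (/-monoˡ-≤ n (<⇒≤ u<s))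
  ... | inj₁ row< = inj₁ row<
  ... | inj₂ row≡ = inj₂ (row≡ , +-cancelʳ-< (row s * n) (col u) (col s) (begin-strict
    col u + row s * n  ≡⟨ cong (λ r → col u + r * n) row≡ ⟨
    col u + row u * n  ≡⟨ col+row*n u ⟩
    u                  <⟨ u<s ⟩
    s                  ≡⟨ col+row*n s ⟨
    col s + row s * n  ∎))
    where open ≤-Reasoning

  suc-decomposition : ∀ u → suc u ≡ suc (col u) + row u * n
  suc-decomposition u = cong suc (sym (col+row*n u))

  col-suc : ∀ u → col (suc u) ≢ 0 → row (suc u) ≡ row u × col (suc u) ≡ suc (col u)
  col-suc u col≢0 with m≤n⇒m<n∨m≡n (col<n u)
  ... | inj₁ 1+col<n = trans (cong row (suc-decomposition u)) ([m+kn]/n≡k (row u) 1+col<n)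
                     , trans (cong col (suc-decomposition u)) ([m+kn]%n≡m (row u) 1+col<n)
  ... | inj₂ 1+col≡n =
    contradiction (trans (cong col (trans (suc-decomposition u) (cong (_+ row u * n) 1+col≡n)))
                         (m*n%n≡0 (suc (row u)) n))
                  col≢0

  IsLeftNeighbour : ℕ → ℕ → Set
  IsLeftNeighbour u s = suc u ≡ s × col s ≢ 0

  leftNeighbour? : ∀ u s → Dec (IsLeftNeighbour u s)
  leftNeighbour? u s = (suc u ≟ s) ×-dec ¬? (col s ≟ 0)

  leftNeighbour-position : ∀ {u s} → IsLeftNeighbour u s → row u ≡ row s × col s ≡ suc (col u)
  leftNeighbour-position {u} (refl , col≢0) with col-suc u col≢0
  ... | row≡ , col≡ = sym row≡ , col≡

  notLeftNeighbour-position : ∀ {u s} → u < s → ¬ IsLeftNeighbour u s →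
    row u < row s ⊎ (row u ≡ row s × suc (col u) < col s)
  notLeftNeighbour-position {u} {s} u<s ¬left with lexicographic u<s
  ... | inj₁ row< = inj₁ row<
  ... | inj₂ (row≡ , col<) with m≤n⇒m<n∨m≡n col<
  ...   | inj₁ 1+col< = inj₂ (row≡ , 1+col<)
  ...   | inj₂ 1+col≡ = contradiction (suc-u≡s , λ col≡0 → 0≢1+n (trans (sym col≡0) (sym 1+col≡)))
                                      ¬left
    where
    suc-u≡s : suc u ≡ s
    suc-u≡s = begin
      suc u                  ≡⟨ suc-decomposition u ⟩
      suc (col u) + row u * n ≡⟨ cong₂ (λ c r → c + r * n) 1+col≡ row≡ ⟩
      col s + row s * n      ≡⟨ col+row*n s ⟩
      s                      ∎
      where open ≡-Reasoning

  module _ {m : ℕ} (u : Fin (m * n)) where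

    toℕ-remQuot : toℕ u ≡ toℕ (proj₂ (remQuot {m} n u)) + toℕ (proj₁ (remQuot {m} n u)) * n
    toℕ-remQuot = begin
      toℕ u                                  ≡⟨ cong toℕ (combine-remQuot {m} n u) ⟨
      toℕ (combine a b)                      ≡⟨ toℕ-combine a b ⟩
      n * toℕ a + toℕ b                      ≡⟨ +-comm (n * toℕ a) (toℕ b) ⟩
      toℕ b + n * toℕ a                      ≡⟨ cong (toℕ b +_) (*-comm n (toℕ a)) ⟩
      toℕ b + toℕ a * n                      ∎
      where
      open ≡-Reasoning
      a = proj₁ (remQuot {m} n u)
      b = proj₂ (remQuot {m} n u)

    row-remQuot : row (toℕ u) ≡ toℕ (proj₁ (remQuot {m} n u))
    row-remQuot = trans (cong row toℕ-remQuot) ([m+kn]/n≡k _ (toℕ<n (proj₂ (remQuot {m} n u))))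

    col-remQuot : col (toℕ u) ≡ toℕ (proj₂ (remQuot {m} n u))
    col-remQuot = trans (cong col toℕ-remQuot)
                        ([m+kn]%n≡m (toℕ (proj₁ (remQuot {m} n u))) (toℕ<n (proj₂ (remQuot {m} n u))))

grid↔ : ∀ {m n} → Fin (m * n) ↔ (Fin m × Fin n)
grid↔ {m} {n} =
  mk↔ₛ′ (remQuot {m} n) (uncurry combine) (uncurry remQuot-combine) (combine-remQuot {m} n)

module GridLabelling (α : Word) (i j n : ℕ) .{{_ : NonZero n}} where
  open Grid n

  -- Columns of H are numbered from 0, so β c is the letter between its columns c and c + 1.
  β : ℕ → Letter
  β c = α (j + c)

  count : ℕ → ℕ
  count = nonZeroCount α j

  gridAdj : ℕ → ℕ → Set
  gridAdj u v = PAdj α (i + row u , j + col u) (i + row v , j + col v)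

  gridAdj-sym : ∀ u v → gridAdj u v → gridAdj v u
  gridAdj-sym u v (inj₁ step) = inj₂ step
  gridAdj-sym u v (inj₂ step) = inj₁ step

  gridAdj-irrefl : ∀ u → ¬ gridAdj u u
  gridAdj-irrefl u (inj₁ (c≡1+c , _)) = 1+n≢n (sym c≡1+c)
  gridAdj-irrefl u (inj₂ (c≡1+c , _)) = 1+n≢n (sym c≡1+c)

  active : ℕ → Bool
  active zero    = isNonZero (β 0)
  active (suc c) = isNonZero (β (suc c)) ∨ isNonZero (β c)

  active-right : ∀ c → T (isNonZero (β c)) → T (active c)
  active-right zero    nz = nz
  active-right (suc c) nz = Equivalence.from T-∨ (inj₁ nz)

  active-left : ∀ c → T (isNonZero (β c)) → T (active (suc c))
  active-left c nz = Equivalence.from T-∨ (inj₂ nz)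

  active-cases : ∀ c → T (active c) → T (isNonZero (β c)) ⊎ ∃[ d ] c ≡ suc d × T (isNonZero (β d))
  active-cases zero    act = inj₁ act
  active-cases (suc c) act =
    [ inj₁ , (λ nz → inj₂ (c , refl , nz)) ] (Equivalence.to (T-∨ {isNonZero (β (suc c))}) act)

  count-sum-strict : ∀ {c c′} → c < c′ → T (active c′) →
                     count c + count (suc c) < count c′ + count (suc c′)
  count-sum-strict {c} {c′} c<c′ act with active-cases c′ act
  ... | inj₁ nz = +-mono-≤-< (nonZeroCount-mono α j (<⇒≤ c<c′)) (begin-strict
    count (suc c)   ≤⟨ nonZeroCount-mono α j c<c′ ⟩
    count c′        <⟨ n<1+n _ ⟩
    suc (count c′)  ≡⟨ nonZeroCount-suc α j c′ nz ⟨
    count (suc c′)  ∎)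
    where open ≤-Reasoning
  ... | inj₂ (d , refl , nz) = +-mono-<-≤ (begin-strict
    count c         ≤⟨ nonZeroCount-mono α j (s≤s⁻¹ c<c′) ⟩
    count d         <⟨ n<1+n _ ⟩
    suc (count d)   ≡⟨ nonZeroCount-suc α j d nz ⟨
    count (suc d)   ∎) (nonZeroCount-mono α j (m≤n⇒m≤1+n c<c′))
    where open ≤-Reasoning

  columnLabel : ℕ → ℕ
  columnLabel c = if active c then 3 + (count c + count (suc c)) else 2

  columnLabel≤ : ∀ c → columnLabel c ≤ 3 + (count c + count (suc c))
  columnLabel≤ c with active c
  ... | true  = ≤-refl
  ... | false = ≤-trans (n≤1+n 2) (m≤m+n 3 _)

  columnLabel-active : ∀ {c} → T (active c) → columnLabel c ≡ 3 + (count c + count (suc c))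
  columnLabel-active {c} act with active c
  ... | true = refl

  2≤columnLabel : ∀ c → 2 ≤ columnLabel c
  2≤columnLabel c with active c
  ... | true  = m≤m+n 2 _
  ... | false = ≤-refl

  3≤columnLabel : ∀ {c} → T (active c) → 3 ≤ columnLabel c
  3≤columnLabel act = subst (3 ≤_) (sym (columnLabel-active act)) (m≤m+n 3 _)

  3≤columnLabel⇒active : ∀ {c} → 3 ≤ columnLabel c → T (active c)
  3≤columnLabel⇒active {c} with active c
  ... | true  = _
  ... | false = λ { (s≤s (s≤s ())) }

  columnLabel≢1 : ∀ c → columnLabel c ≢ 1
  columnLabel≢1 c eq = <⇒≢ (2≤columnLabel c) (sym eq)

  columnLabel-strict : ∀ {c c′} → c < c′ → T (active c′) → columnLabel c < columnLabel c′
  columnLabel-strict {c} {c′} c<c′ act = begin-strict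
    columnLabel c                     ≤⟨ columnLabel≤ c ⟩
    3 + (count c + count (suc c))     <⟨ +-monoʳ-< 3 (count-sum-strict c<c′ act) ⟩
    3 + (count c′ + count (suc c′))   ≡⟨ columnLabel-active act ⟨
    columnLabel c′                    ∎
    where open ≤-Reasoning

  columnLabel-injective : ∀ {c c′} → T (active c) → columnLabel c′ ≡ columnLabel c → c′ ≡ c
  columnLabel-injective {c} {c′} act eq with <-cmp c′ c
  ... | tri< c′<c _ _ = contradiction eq (<⇒≢ (columnLabel-strict c′<c act))
  ... | tri≈ _ c′≡c _ = c′≡c
  ... | tri> _ _ c<c′ = contradiction (sym eq) (<⇒≢ (columnLabel-strict c<c′ act′))
    where
    act′ = 3≤columnLabel⇒active (subst (3 ≤_) (sym eq) (3≤columnLabel act))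

  columnLabel-bound : ∀ {c} → c < n → columnLabel c ≤ 3 + (count (n ∸ 1) + suc (count (n ∸ 1)))
  columnLabel-bound {c} c<n = ≤-trans (columnLabel≤ c) (+-monoʳ-≤ 3 (+-mono-≤ count≤ count-suc≤))
    where
    count≤ : count c ≤ count (n ∸ 1)
    count≤ = nonZeroCount-mono α j (∸-monoˡ-≤ 1 c<n)
    count-suc≤ : count (suc c) ≤ suc (count (n ∸ 1))
    count-suc≤ = ≤-trans (nonZeroCount-suc-≤ α j c) (s≤s count≤)

  labelAt : ℕ → ℕ → ℕ
  labelAt s u = if does (leftNeighbour? u s) then 1 else columnLabel (col u)

  labelAt-left : ∀ {s u} → IsLeftNeighbour u s → labelAt s u ≡ 1
  labelAt-left {s} {u} left rewrite dec-true (leftNeighbour? u s) left = refl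

  labelAt-notLeft : ∀ {s u} → ¬ IsLeftNeighbour u s → labelAt s u ≡ columnLabel (col u)
  labelAt-notLeft {s} {u} ¬left rewrite dec-false (leftNeighbour? u s) ¬left = refl

  labelAt-later : ∀ {s u} → u < s → labelAt (suc s) u ≡ columnLabel (col u)
  labelAt-later u<s = labelAt-notLeft (λ (1+u≡1+s , _) → <⇒≢ u<s (suc-injective 1+u≡1+s))

  LeftJoin : ℕ → ℕ → Set
  LeftJoin zero    l = ⊥
  LeftJoin (suc c) l = (l ≡ 1 × T (relatesEqual (β c)))
                     ⊎ (l ≡ columnLabel c × T (relatesUpward (β c)))

  RightJoin : ℕ → ℕ → Set
  RightJoin b l = suc b < n × l ≡ columnLabel (suc b) × T (relatesDownward (β b))

  JoinsAt : ℕ → ℕ → Set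
  JoinsAt b l = LeftJoin b l ⊎ RightJoin b l

  joinsAt? : ∀ b l → Dec (JoinsAt b l)
  joinsAt? b l = leftJoin? b ⊎-dec ((suc b <? n) ×-dec (l ≟ columnLabel (suc b)) ×-dec T? _)
    where
    leftJoin? : ∀ b → Dec (LeftJoin b l)
    leftJoin? zero    = no λ ()
    leftJoin? (suc c) = ((l ≟ 1) ×-dec T? _) ⊎-dec ((l ≟ columnLabel c) ×-dec T? _)

  joinsAt-recent⇔ : ∀ c → JoinsAt (suc c) 1 ⇔ T (relatesEqual (β c))
  joinsAt-recent⇔ c = mk⇔ to (λ eq → inj₁ (inj₁ (refl , eq)))
    where
    to : JoinsAt (suc c) 1 → T (relatesEqual (β c))
    to (inj₁ (inj₁ (_ , eq))) = eq
    to (inj₁ (inj₂ (1≡ , _))) = ⊥-elim (columnLabel≢1 c (sym 1≡))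
    to (inj₂ (_ , 1≡ , _))    = ⊥-elim (columnLabel≢1 (suc (suc c)) (sym 1≡))

  LaterRowAdjacent : ℕ → ℕ → Set
  LaterRowAdjacent c b = (b ≡ suc c × T (relatesUpward (β c))) ⊎ (c ≡ suc b × T (relatesDownward (β b)))

  joinsAt-columnLabel⇔ : ∀ {b c} → c < n →
    JoinsAt b (columnLabel c) ⇔ LaterRowAdjacent c b
  joinsAt-columnLabel⇔ {b} {c} c<n = mk⇔ (to b) from
    where
    to : ∀ b → JoinsAt b (columnLabel c) → LaterRowAdjacent c b
    to (suc d) (inj₁ (inj₁ (≡1 , _))) = ⊥-elim (columnLabel≢1 c ≡1)
    to (suc d) (inj₁ (inj₂ (eq , up)))
      with columnLabel-injective (active-right d (relatesUpward⇒isNonZero (β d) up)) eq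
    ... | refl = inj₁ (refl , up)
    to b (inj₂ (_ , eq , down))
      with columnLabel-injective (active-left b (relatesDownward⇒isNonZero (β b) down)) eq
    ... | refl = inj₂ (refl , down)
    from : LaterRowAdjacent c b → JoinsAt b (columnLabel c)
    from (inj₁ (refl , up))   = inj₁ (inj₂ (refl , up))
    from (inj₂ (refl , down)) = inj₂ (c<n , refl , down)

  ColumnStep : ℕ → ℕ → ℕ → ℕ → Set
  ColumnStep c b x y = (b ≡ suc c × LetterRel (β c) x y) ⊎ (c ≡ suc b × LetterRel (β b) y x)

  PAdj⇔ColumnStep : ∀ x y c b → PAdj α (x , j + c) (y , j + b) ⇔ ColumnStep c b x y
  PAdj⇔ColumnStep x y c b = (shift⇔ ×-⇔ ⇔-id _) ⊎-⇔ (shift⇔ ×-⇔ ⇔-id _)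
    where
    shift⇔ : ∀ {c b} → j + b ≡ suc (j + c) ⇔ b ≡ suc c
    shift⇔ {c} {b} = mk⇔ (λ eq → +-cancelˡ-≡ j b (suc c) (trans eq (sym (+-suc j c))))
                         (λ { refl → +-suc j c })

  nonAdjacentColumns : ∀ {c b} {A B : Set} → suc c < b → ¬ ((b ≡ suc c × A) ⊎ (c ≡ suc b × B))
  nonAdjacentColumns 1+c<b (inj₁ (refl , _)) = <-irrefl refl 1+c<b
  nonAdjacentColumns 1+c<b (inj₂ (refl , _)) = <-irrefl refl (<-trans (m<n⇒m<1+n (n<1+n _)) 1+c<b)

  columnStep-sameRow⇔ : ∀ c x → ColumnStep c (suc c) x x ⇔ T (relatesEqual (β c))
  columnStep-sameRow⇔ c x =
    mk⇔ to (λ eq → inj₁ (refl , Equivalence.from (LetterRel-refl⇔ (β c) x) eq))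
    where
    to : ColumnStep c (suc c) x x → T (relatesEqual (β c))
    to (inj₁ (_ , rel))      = Equivalence.to (LetterRel-refl⇔ (β c) x) rel
    to (inj₂ (c≡2+c , _))    = contradiction c≡2+c (<⇒≢ (m<n⇒m<1+n (n<1+n c)))

  columnStep-later⇔ : ∀ {a′ a c b} → a′ < a ⊎ (a′ ≡ a × suc c < b) →
    ColumnStep c b (i + a′) (i + a) ⇔ LaterRowAdjacent c b
  columnStep-later⇔ {c = c} {b} (inj₁ a′<a) =
    (⇔-id _ ×-⇔ LetterRel-<⇔ (β c) (+-monoʳ-< i a′<a))
    ⊎-⇔ (⇔-id _ ×-⇔ LetterRel->⇔ (β b) (+-monoʳ-< i a′<a))
  columnStep-later⇔ (inj₂ (_ , 1+c<b)) =
    mk⇔ (λ step → contradiction step (nonAdjacentColumns 1+c<b))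
        (λ step → contradiction step (nonAdjacentColumns 1+c<b))

  adjacent⇔joins : ∀ {s u} → u < s → gridAdj u s ⇔ JoinsAt (col s) (labelAt s u)
  adjacent⇔joins {s} {u} u<s = byPosition (leftNeighbour? u s)
    where
    open EquationalReasoning
    byPosition : Dec (IsLeftNeighbour u s) → gridAdj u s ⇔ JoinsAt (col s) (labelAt s u)
    byPosition (yes left) = let row≡ , col≡ = leftNeighbour-position left in begin
      gridAdj u s
        ∼⟨ PAdj⇔ColumnStep _ _ _ _ ⟩
      ColumnStep (col u) (col s) (i + row u) (i + row s)
        ≡⟨ cong₂ (λ b a → ColumnStep (col u) b (i + row u) (i + a)) col≡ (sym row≡) ⟩
      ColumnStep (col u) (suc (col u)) (i + row u) (i + row u)
        ∼⟨ columnStep-sameRow⇔ _ _ ⟩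
      T (relatesEqual (β (col u)))
        ∼⟨ ⇔-sym (joinsAt-recent⇔ _) ⟩
      JoinsAt (suc (col u)) 1
        ≡⟨ cong₂ JoinsAt (sym col≡) (sym (labelAt-left left)) ⟩
      JoinsAt (col s) (labelAt s u) ∎
    byPosition (no ¬left) = begin
      gridAdj u s
        ∼⟨ PAdj⇔ColumnStep _ _ _ _ ⟩
      ColumnStep (col u) (col s) (i + row u) (i + row s)
        ∼⟨ columnStep-later⇔ (notLeftNeighbour-position u<s ¬left) ⟩
      LaterRowAdjacent (col u) (col s)
        ∼⟨ ⇔-sym (joinsAt-columnLabel⇔ (col<n u)) ⟩
      JoinsAt (col s) (columnLabel (col u))
        ≡⟨ cong (JoinsAt (col s)) (labelAt-notLeft ¬left) ⟨
      JoinsAt (col s) (labelAt s u) ∎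

  labelAt-bound : ∀ s u → labelAt s u ≤ 3 + (count (n ∸ 1) + suc (count (n ∸ 1)))
  labelAt-bound s u with does (leftNeighbour? u s)
  ... | true  = s≤s z≤n
  ... | false = columnLabel-bound (col<n u)

  labelAt≢0 : ∀ s u → labelAt s u ≢ 0
  labelAt≢0 s u with does (leftNeighbour? u s)
  ... | true  = λ ()
  ... | false = m<n⇒n≢0 (2≤columnLabel (col u))

  gridLabelling : ∀ {k} → 3 + (count (n ∸ 1) + suc (count (n ∸ 1))) < k →
                  LinearLabelling k gridAdj
  gridLabelling labels<k = record
    { labelAt        = labelAt
    ; Joins          = λ s → JoinsAt (col s)
    ; joins?         = λ s → joinsAt? (col s)
    ; retire         = λ s → columnLabel (col (pred s))
    ; labelAt<k      = λ {s} {u} _ → ≤-<-trans (labelAt-bound s u) labels<k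
    ; retire<k       = λ s → ≤-<-trans (columnLabel-bound (col<n (pred s))) labels<k
    ; labelAt≢0      = λ {s} {u} _ → labelAt≢0 s u
    ; adjacent⇔joins = adjacent⇔joins
    ; labelAt-retire = retired
    ; labelAt-keep   = kept
    }
    where
    retired : ∀ {s u} → u < s → labelAt s u ≡ 1 →
              labelAt (suc s) u ≡ columnLabel (col (pred s))
    retired {s} {u} u<s ≡1 with leftNeighbour? u s
    ... | yes (refl , _) = labelAt-later u<s
    ... | no ¬left = contradiction (trans (sym (labelAt-notLeft ¬left)) ≡1) (columnLabel≢1 (col u))
    kept : ∀ {s u} → u < s → labelAt s u ≢ 1 → labelAt (suc s) u ≡ labelAt s u
    kept {s} {u} u<s ≢1 with leftNeighbour? u s
    ... | yes left = contradiction (labelAt-left left) ≢1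
    ... | no ¬left = trans (labelAt-later u<s) (sym (labelAt-notLeft ¬left))

  gridAdj≡E : ∀ {m} (u v : Fin (m * n)) →
    gridAdj (toℕ u) (toℕ v) ≡ E (H α i j m n) (Inverse.to grid↔ u) (Inverse.to grid↔ v)
  gridAdj≡E {m} u v = cong₂ (PAdj α) (cell u) (cell v)
    where
    cell : (w : Fin (m * n)) → (i + row (toℕ w) , j + col (toℕ w))
                             ≡ (i + toℕ (proj₁ (remQuot {m} n w)) , j + toℕ (proj₂ (remQuot {m} n w)))
    cell w = cong₂ _,_ (cong (i +_) (row-remQuot {m} w)) (cong (j +_) (col-remQuot {m} w))

3+[t+1+t]<6t+3 : ∀ {t} → 1 ≤ t → 3 + (t + suc t) < 6 * t + 3
3+[t+1+t]<6t+3 {suc t} _ = subst (suc (3 + (suc t + suc (suc t))) ≤_) (sym (shape t)) (m≤m+n _ _)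
  where
  shape : ∀ t → 6 * suc t + 3 ≡ suc (3 + (suc t + suc (suc t))) + (2 + 4 * t)
  shape = solve-∀

corollary4p2 : (α : Word) (n j t : ℕ) → 2 ≤ n → 1 ≤ j →
    nonZeroCount α j (n ∸ 1) ≡ t → 1 ≤ t →
    (i m : ℕ) → 1 ≤ i → 1 ≤ m →
    CliqueWidth≤ (H α i j m n) (6 * t + 3)
-- The hypotheses 1 ≤ i and 1 ≤ j only reflect the paper's 1-based indexing, and 2 ≤ n is
-- only needed for n ≢ 0: the construction works for all offsets i, j.
corollary4p2 α n@(suc (suc _)) j t (s≤s (s≤s _)) _ count≡t 1≤t i m@(suc _) _ (s≤s _) =
  _ , e , record { bij = grid↔ ; preserves = λ u v → subst (edge e u v ⇔_) (gridAdj≡E u v) (edge⇔ u v) }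
  where
  open GridLabelling α i j n
  1<k : 1 < 6 * t + 3
  1<k = ≤-trans (s≤s (s≤s z≤n)) (m≤n+m 3 (6 * t))
  labels<k : 3 + (count (n ∸ 1) + suc (count (n ∸ 1))) < 6 * t + 3
  labels<k = subst (λ c → 3 + (c + suc c) < 6 * t + 3) (sym count≡t) (3+[t+1+t]<6t+3 1≤t)
  linear = linearExpression gridAdj-sym gridAdj-irrefl 1<k (gridLabelling labels<k) _
  e = proj₁ linear
  open Represents (proj₂ linear)
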